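{- Let $\sigma$ be a chip configuration on $K_n$. If $a(\sigma)=p/q$ with $p,q$ coprime integers, $q\ge1$, then the eventual period of $\sigma$ is $m(\sigma)=q$.
   Context: Parallel chip-firing on $K_n$: $\sigma:[n]\to\mathbb{Z}_{\ge0}$, $r(\sigma)=\#\{v:\sigma(v)\ge n\}$, $U\sigma(v)=\sigma(v)+r(\sigma)$ if $\sigma(v)\le n-1$, $U\sigma(v)=\sigma(v)-n+r(\sigma)$ if $\sigma(v)\ge n$. The activity is $a(\sigma)=\lim_{t\to\infty}\frac{\alpha_t}{nt}$ with $\alpha_t=\sum_{s=0}^{t-1}r(U^s\sigma)$ (the limit exists since the orbit is eventually periodic). The eventual period $m(\sigma)$ is the least $m\ge1$ with $U^{t+m}\sigma=U^t\sigma$ for all sufficiently large $t$. -}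

module Defs where

open import Data.Nat using (ℕ; zero; suc; _+_; _*_; _∸_; _≤_; _<_; _≥_; _≤ᵇ_; NonZero)
open import Data.Nat.Properties using (_≤?_)
open import Data.Fin using (Fin)
open import Data.List using (List; length; filter; allFin)
open import Data.Bool using (Bool; true; false; if_then_else_)
open import Data.Integer using (ℤ; +_)
open import Data.Rational.Unnormalised as Q using (ℚᵘ; ∣_∣; _-_)
open import Relation.Binary.PropositionalEquality using (_≡_)
open import Data.Product using (Σ; _×_; ∃)
open import Relation.Nullary using (¬_)

Config : ℕ → Set
Config n = Fin n → ℕ

r : {n : ℕ} → Config n → ℕ
r {n} σ = length (filter (λ v → n ≤? σ v) (allFin n))

U : {n : ℕ} → Config n → Config n
U {n} σ v = if n ≤ᵇ σ v then (σ v ∸ n) + r σ else σ v + r σ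

iterU : {n : ℕ} → ℕ → Config n → Config n
iterU zero    σ = σ
iterU (suc t) σ = U (iterU t σ)

α : {n : ℕ} → Config n → ℕ → ℕ
α σ zero    = 0
α σ (suc t) = α σ t + r (iterU t σ)

-- α_t / (n t) as an (unnormalised) rational, for t ≥ 1 and n ≥ 1
-- (we use t = suc k and n = suc n', so n t = suc (n' + k * suc n') is nonzero).
ratio : {n : ℕ} → Config (suc n) → ℕ → ℚᵘ
ratio {n} σ k = Q._/_ (+ α σ (suc k)) (suc n * suc k)

HasActivity : {n : ℕ} → Config (suc n) → ℚᵘ → Set
HasActivity σ L =
  ∀ (ε : ℚᵘ) → Q.0ℚᵘ Q.< ε →
    ∃ λ N → ∀ k → N ≤ k → ∣ ratio σ k - L ∣ Q.< ε

IsEventualPeriodOf : {n : ℕ} → Config n → ℕ → Set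
IsEventualPeriodOf σ m =
  ∃ λ T → ∀ t → T ≤ t → ∀ v → iterU (t + m) σ v ≡ iterU t σ v

EventualPeriod : {n : ℕ} → Config n → ℕ → Set
EventualPeriod σ m =
  (1 ≤ m × IsEventualPeriodOf σ m) ×
  (∀ m' → 1 ≤ m' → IsEventualPeriodOf σ m' → m ≤ m')

module Submission where

-- Let F_t(v) count the firings of v before time t. Every vertex receives r chips per
-- step and loses n per firing, so σ_t(v) + n F_t(v) = σ(v) + α_t. Chips are conserved,
-- so the orbit is eventually periodic; over an eventual period m every vertex fires the
-- same number k of times, α grows by n k per period and the activity is k/m. Hence
-- k q = p m and, p and q being coprime, q divides every eventual period. Conversely, the
-- dynamics is monotone: an inequality F_x(u) + a ≤ F_y(v) + b between firing counts
-- that is compatible with the invariant persists under further steps. In the periodic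
-- regime this shows that any two vertices fire equally often up to one over every
-- window, and then that every window of q steps contains exactly p firings per vertex,
-- so q itself is a period.

open import Defs
open import Data.Bool using (true; false; T; if_then_else_)
open import Data.Empty using (⊥; ⊥-elim)
open import Data.Fin as Fin using (Fin; toℕ; fromℕ<; funToFin; finToFun)
open import Data.Fin.Properties using (pigeonhole; toℕ-fromℕ<; finToFun-funToFin; all?; ¬∀⟶∃¬)
open import Data.List using (List; []; _∷_; length; filter; allFin)
open import Data.List.Properties using (length-tabulate)
open import Data.List.Membership.Propositional using (_∈_)
open import Data.List.Membership.Propositional.Properties using (∈-allFin)
open import Data.List.Relation.Unary.Any using (here; there)
open import Data.Nat using (ℕ; zero; suc; _+_; _*_; _∸_; _^_; _≤_; _<_; _≤ᵇ_; z≤n; s≤s; z<s; NonZero; >-nonZero; ≢-nonZero⁻¹)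
open import Data.Nat.Properties
open import Data.Nat.Coprimality as Coprime using (Coprime; coprime-divisor)
open import Data.Nat.Divisibility using (_∣_; divides; ∣⇒≤)
open import Data.Nat.Tactic.RingSolver using (solve-∀)
open import Data.Integer as ℤ using (ℤ)
import Data.Integer.Properties as ℤ
import Data.Integer.Tactic.RingSolver as ℤ-Solver
open import Data.Rational.Unnormalised as ℚ using (ℚᵘ; mkℚᵘ)
open import Algebra.Properties.CommutativeSemigroup +-commutativeSemigroup
  using (interchange; x∙yz≈y∙xz; x∙yz≈xz∙y; xy∙z≈xz∙y; xy∙z≈x∙zy; xy∙z≈zy∙x)
open import Data.Product using (∃; ∃₂; _×_; _,_; proj₁; proj₂)
open import Data.Sum using (_⊎_; inj₁; inj₂)
open import Relation.Binary.PropositionalEquality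
open import Relation.Nullary using (does; yes; no)
open import Relation.Unary using (Decidable)

∑ : {A : Set} → List A → (A → ℕ) → ℕ
∑ []       f = 0
∑ (x ∷ xs) f = f x + ∑ xs f

module _ {A : Set} where

  ∑-cong : (xs : List A) {f g : A → ℕ} → (∀ x → f x ≡ g x) → ∑ xs f ≡ ∑ xs g
  ∑-cong []       f≗g = refl
  ∑-cong (x ∷ xs) f≗g = cong₂ _+_ (f≗g x) (∑-cong xs f≗g)

  ∑-mono-≤ : (xs : List A) {f g : A → ℕ} → (∀ x → f x ≤ g x) → ∑ xs f ≤ ∑ xs g
  ∑-mono-≤ []       f≤g = z≤n
  ∑-mono-≤ (x ∷ xs) f≤g = +-mono-≤ (f≤g x) (∑-mono-≤ xs f≤g)

  ∑-distrib-+ : (xs : List A) (f g : A → ℕ) → ∑ xs (λ x → f x + g x) ≡ ∑ xs f + ∑ xs g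
  ∑-distrib-+ []       f g = refl
  ∑-distrib-+ (x ∷ xs) f g =
    trans (cong (f x + g x +_) (∑-distrib-+ xs f g)) (interchange (f x) (g x) (∑ xs f) (∑ xs g))

  ∑-*ˡ : (xs : List A) (c : ℕ) (f : A → ℕ) → ∑ xs (λ x → c * f x) ≡ c * ∑ xs f
  ∑-*ˡ []       c f = sym (*-zeroʳ c)
  ∑-*ˡ (x ∷ xs) c f = trans (cong (c * f x +_) (∑-*ˡ xs c f)) (sym (*-distribˡ-+ c (f x) (∑ xs f)))

  ∑-const : (xs : List A) (c : ℕ) → ∑ xs (λ _ → c) ≡ length xs * c
  ∑-const []       c = refl
  ∑-const (x ∷ xs) c = cong (c +_) (∑-const xs c)

  ∈⇒≤∑ : (xs : List A) (f : A → ℕ) {x : A} → x ∈ xs → f x ≤ ∑ xs f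
  ∈⇒≤∑ (y ∷ xs) f (here refl) = m≤m+n (f y) (∑ xs f)
  ∈⇒≤∑ (y ∷ xs) f (there x∈xs) = ≤-trans (∈⇒≤∑ xs f x∈xs) (m≤n+m (∑ xs f) (f y))

  length-filter≡∑ : {P : A → Set} (P? : Decidable P) (xs : List A) →
                    length (filter P? xs) ≡ ∑ xs (λ x → if does (P? x) then 1 else 0)
  length-filter≡∑ P? []       = refl
  length-filter≡∑ P? (x ∷ xs) with does (P? x)
  ... | true  = cong suc (length-filter≡∑ P? xs)
  ... | false = length-filter≡∑ P? xs

∑-allFin-const : (N c : ℕ) → ∑ (allFin N) (λ _ → c) ≡ N * c
∑-allFin-const N c = trans (∑-const (allFin N) c) (cong (_* c) (length-tabulate {n = N} (λ v → v)))

ℕ-pigeonhole : ∀ {K} (g : ℕ → Fin K) → ∃₂ λ i j → i < j × g i ≡ g j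
ℕ-pigeonhole {K} g with i , j , i<j , gᵢ≡gⱼ ← pigeonhole (n<1+n K) (λ t → g (toℕ t))
  = toℕ i , toℕ j , i<j , gᵢ≡gⱼ

bounded-sequence-repeats : ∀ {N} B (s : ℕ → Fin N → ℕ) → (∀ t v → s t v ≤ B) →
                           ∃₂ λ i j → i < j × (∀ v → s i v ≡ s j v)
bounded-sequence-repeats {N} B s bound =
  let i , j , i<j , codeᵢ≡codeⱼ = ℕ-pigeonhole code
  in  i , j , i<j , λ v → trans (decode i v) (trans (cong (λ c → toℕ (finToFun c v)) codeᵢ≡codeⱼ) (sym (decode j v)))
  where
  code : ℕ → Fin (suc B ^ N)
  code t = funToFin (λ v → fromℕ< (s≤s (bound t v)))
  decode : ∀ t v → s t v ≡ toℕ (finToFun (code t) v)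
  decode t v = trans (sym (toℕ-fromℕ< (s≤s (bound t v)))) (cong toℕ (sym (finToFun-funToFin _ v)))

∀≥-from-offsets : ∀ {T} (P : ℕ → Set) → (∀ d → P (d + T)) → ∀ t → T ≤ t → P t
∀≥-from-offsets {T} P P[d+T] t T≤t =
  let d , T+d≡t = m≤n⇒∃[o]m+o≡n T≤t in subst P (trans (+-comm d T) T+d≡t) (P[d+T] d)

+-mono-≤-unless-tie : ∀ {x y e₁ e₂} → x ≤ y → (x ≡ y → e₁ ≤ e₂) → e₁ ≤ 1 → x + e₁ ≤ y + e₂
+-mono-≤-unless-tie {x} {y} {e₁} {e₂} x≤y tie e₁≤1 with m≤n⇒m<n∨m≡n x≤y
... | inj₂ x≡y = +-mono-≤ x≤y (tie x≡y)
... | inj₁ x<y = begin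
  x + e₁ ≤⟨ +-monoʳ-≤ x e₁≤1 ⟩
  x + 1  ≡⟨ +-comm x 1 ⟩
  suc x  ≤⟨ x<y ⟩
  y      ≤⟨ m≤m+n y e₂ ⟩
  y + e₂ ∎
  where open ≤-Reasoning

module _ (g : ℕ → ℕ) (P : ℕ) where

  growth-≥ : (∀ i → g i + P ≤ g (suc i)) → ∀ i → g 0 + i * P ≤ g i
  growth-≥ step zero    = ≤-reflexive (+-identityʳ (g 0))
  growth-≥ step (suc i) = begin
    g 0 + (P + i * P) ≡⟨ x∙yz≈xz∙y (g 0) P (i * P) ⟩
    g 0 + i * P + P   ≤⟨ +-monoˡ-≤ P (growth-≥ step i) ⟩
    g i + P           ≤⟨ step i ⟩
    g (suc i)         ∎
    where open ≤-Reasoning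

  growth-≤ : (∀ i → g (suc i) ≤ g i + P) → ∀ i → g i ≤ g 0 + i * P
  growth-≤ step zero    = ≤-reflexive (sym (+-identityʳ (g 0)))
  growth-≤ step (suc i) = begin
    g (suc i)         ≤⟨ step i ⟩
    g i + P           ≤⟨ +-monoˡ-≤ P (growth-≤ step i) ⟩
    g 0 + i * P + P   ≡⟨ sym (x∙yz≈xz∙y (g 0) P (i * P)) ⟩
    g 0 + (P + i * P) ∎
    where open ≤-Reasoning

module _ (g : ℕ → ℕ) (P j : ℕ) (g[1+j] : g (suc j) ≡ g 0 + suc j * P) where

  private
    g[1+j]′ : g (suc j) ≡ g 0 + P + j * P
    g[1+j]′ = trans g[1+j] (sym (+-assoc (g 0) P (j * P)))

  forced-step-≥ : (∀ i → g i + P ≤ g (suc i)) → g 1 ≡ g 0 + P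
  forced-step-≥ step = ≤-antisym
    (+-cancelʳ-≤ (j * P) _ _ (subst (g 1 + j * P ≤_) g[1+j]′ (growth-≥ (λ i → g (suc i)) P (λ i → step (suc i)) j)))
    (step 0)

  forced-step-≤ : (∀ i → g (suc i) ≤ g i + P) → g 1 ≡ g 0 + P
  forced-step-≤ step = ≤-antisym
    (step 0)
    (+-cancelʳ-≤ (j * P) _ _ (subst (_≤ g 1 + j * P) g[1+j]′ (growth-≤ (λ i → g (suc i)) P (λ i → step (suc i)) j)))

fires : ℕ → ℕ → ℕ
fires N x = if N ≤ᵇ x then 1 else 0

fires≤1 : ∀ N x → fires N x ≤ 1
fires≤1 N x with N ≤ᵇ x
... | true  = ≤-refl
... | false = z≤n

fires-mono : ∀ N {x y} → x ≤ y → fires N x ≤ fires N y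
fires-mono N {x} {y} x≤y with N ≤ᵇ x in N≤ᵇx | N ≤ᵇ y in N≤ᵇy
... | false | _     = z≤n
... | true  | true  = ≤-refl
... | true  | false = ⊥-elim (subst T N≤ᵇy (≤⇒≤ᵇ (≤-trans (≤ᵇ⇒≤ N x (subst T (sym N≤ᵇx) _)) x≤y)))

r≡∑fires : ∀ {N} (τ : Config N) → r τ ≡ ∑ (allFin N) (λ v → fires N (τ v))
r≡∑fires {N} τ = length-filter≡∑ (λ v → N ≤? τ v) (allFin N)

r-cong : ∀ {N} {τ τ′ : Config N} → (∀ v → τ v ≡ τ′ v) → r τ ≡ r τ′
r-cong {N} {τ} {τ′} τ≗τ′ =
  trans (r≡∑fires τ) (trans (∑-cong (allFin N) (λ v → cong (fires N) (τ≗τ′ v))) (sym (r≡∑fires τ′)))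

U-cong : ∀ {N} {τ τ′ : Config N} → (∀ v → τ v ≡ τ′ v) → ∀ v → U τ v ≡ U τ′ v
U-cong τ≗τ′ v rewrite τ≗τ′ v | r-cong τ≗τ′ = refl

iterU-cong : ∀ {N} {τ τ′ : Config N} → (∀ v → τ v ≡ τ′ v) → ∀ d v → iterU d τ v ≡ iterU d τ′ v
iterU-cong τ≗τ′ zero    = τ≗τ′
iterU-cong τ≗τ′ (suc d) = U-cong (iterU-cong τ≗τ′ d)

iterU-+ : ∀ {N} d t (τ : Config N) → iterU (d + t) τ ≡ iterU d (iterU t τ)
iterU-+ zero    t τ = refl
iterU-+ (suc d) t τ = cong U (iterU-+ d t τ)

-- HasActivity σ L unfolds to AverageTendsTo n (α σ) L.
AverageTendsTo : ℕ → (ℕ → ℕ) → ℚᵘ → Set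
AverageTendsTo d f L =
  ∀ ε → ℚ.0ℚᵘ ℚ.< ε → ∃ λ K → ∀ k → K ≤ k → ℚ.∣ ℤ.+ f (suc k) ℚ./ (suc d * suc k) ℚ.- L ∣ ℚ.< ε

distance<⇒numerator< : ∀ (a p : ℤ) (d′ q′ e : ℕ) →
                       ℚ.∣ a ℚ./ suc d′ ℚ.- p ℚ./ suc q′ ∣ ℚ.< mkℚᵘ (ℤ.+ 1) e →
                       ℤ.∣ a ℤ.* ℤ.+ suc q′ ℤ.+ ℤ.- p ℤ.* ℤ.+ suc d′ ∣ * suc e < suc d′ * suc q′
distance<⇒numerator< a p d′ q′ e (ℚ.*<* lt) =
  subst (ℤ.∣ numerator ∣ * suc e <_) (*-identityˡ _)
    (ℤ.drop‿+<+ (subst₂ ℤ._<_ (sym (ℤ.pos-* ℤ.∣ numerator ∣ (suc e))) (sym (ℤ.pos-* 1 (suc d′ * suc q′))) lt))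
  where numerator = a ℤ.* ℤ.+ suc q′ ℤ.+ ℤ.- p ℤ.* ℤ.+ suc d′

progression-outgrows : ∀ c D m Q X Y t₁ .{{_ : NonZero D}} .{{_ : NonZero m}} .{{_ : NonZero Q}} →
  c * D ≤ X + Y → X * suc (2 * m * Q) < D * (t₁ + c * m) * Q → D * t₁ * Q + Y * suc (2 * m * Q) ≤ c → ⊥
progression-outgrows c D m Q X Y t₁ cD≤X+Y X-small c-large =
  <-irrefl refl (<-≤-trans cM<c (m≤m*n c M {{m*n≢0 (D * m) Q {{m*n≢0 D m}}}}))
  where
  open ≤-Reasoning
  M = D * m * Q
  e = 2 * m * Q
  double : ∀ c D m Q → c * D * (2 * m * Q) ≡ c * (D * m * Q) + c * (D * m * Q)
  double = solve-∀
  split : ∀ c D m Q t₁ → D * (t₁ + c * m) * Q ≡ c * (D * m * Q) + D * t₁ * Q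
  split = solve-∀
  cM<c : c * M < c
  cM<c = +-cancelˡ-< (c * M) (c * M) c (begin-strict
    c * M + c * M                       ≡⟨ double c D m Q ⟨
    c * D * e                           ≤⟨ *-monoʳ-≤ (c * D) (n≤1+n e) ⟩
    c * D * suc e                       ≤⟨ *-monoˡ-≤ (suc e) cD≤X+Y ⟩
    (X + Y) * suc e                     ≡⟨ *-distribʳ-+ (suc e) X Y ⟩
    X * suc e + Y * suc e               <⟨ +-monoˡ-< (Y * suc e) X-small ⟩
    D * (t₁ + c * m) * Q + Y * suc e    ≡⟨ cong (_+ Y * suc e) (split c D m Q t₁) ⟩
    c * M + D * t₁ * Q + Y * suc e      ≡⟨ +-assoc (c * M) _ _ ⟩
    c * M + (D * t₁ * Q + Y * suc e)    ≤⟨ +-monoʳ-≤ (c * M) c-large ⟩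
    c * M + c                           ∎)

module ArithmeticProgression (f : ℕ → ℕ) (d′ : ℕ) (p : ℤ) (q′ t₀ m K : ℕ)
         (progression : ∀ c → f (suc t₀ + c * m) ≡ f (suc t₀) + suc d′ * (c * K)) where

  D = suc d′
  Q = suc q′
  t₁ = suc t₀

  numerator : ℕ → ℤ
  numerator c = ℤ.+ f (t₁ + c * m) ℤ.* ℤ.+ Q ℤ.+ ℤ.- p ℤ.* ℤ.+ (D * (t₁ + c * m))

  offset : ℤ
  offset = ℤ.+ f t₁ ℤ.* ℤ.+ Q ℤ.+ ℤ.- p ℤ.* ℤ.+ (D * t₁)

  drift : ℤ
  drift = ℤ.+ (K * Q) ℤ.- p ℤ.* ℤ.+ m

  numerator-affine : ∀ c → numerator c ℤ.- offset ≡ ℤ.+ (c * D) ℤ.* drift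
  numerator-affine c = begin
    numerator c ℤ.- offset
      ≡⟨ cong₂ (λ a b → a ℤ.* ℤ.+ Q ℤ.+ ℤ.- p ℤ.* b ℤ.- offset) cast-value cast-time ⟩
    grown ℤ.- offset
      ≡⟨ cong (λ b → grown ℤ.- (A ℤ.* ℤ.+ Q ℤ.+ ℤ.- p ℤ.* b)) (ℤ.pos-* D t₁) ⟩
    grown ℤ.- (A ℤ.* ℤ.+ Q ℤ.+ ℤ.- p ℤ.* (ℤ.+ D ℤ.* ℤ.+ t₁))
      ≡⟨ regroup A (ℤ.+ D) (ℤ.+ c) (ℤ.+ K) (ℤ.+ Q) (ℤ.+ t₁) (ℤ.+ m) p ⟩
    ℤ.+ c ℤ.* ℤ.+ D ℤ.* (ℤ.+ K ℤ.* ℤ.+ Q ℤ.- p ℤ.* ℤ.+ m)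
      ≡⟨ cong₂ (λ a b → a ℤ.* (b ℤ.- p ℤ.* ℤ.+ m)) (ℤ.pos-* c D) (ℤ.pos-* K Q) ⟨
    ℤ.+ (c * D) ℤ.* drift ∎
    where
    open ≡-Reasoning
    A = ℤ.+ f t₁
    grown = (A ℤ.+ ℤ.+ D ℤ.* (ℤ.+ c ℤ.* ℤ.+ K)) ℤ.* ℤ.+ Q ℤ.+ ℤ.- p ℤ.* (ℤ.+ D ℤ.* (ℤ.+ t₁ ℤ.+ ℤ.+ c ℤ.* ℤ.+ m))
    cast-value : ℤ.+ f (t₁ + c * m) ≡ A ℤ.+ ℤ.+ D ℤ.* (ℤ.+ c ℤ.* ℤ.+ K)
    cast-value = trans (cong ℤ.+_ (progression c))
      (trans (ℤ.pos-+ (f t₁) _) (cong (λ x → A ℤ.+ x) (trans (ℤ.pos-* D (c * K)) (cong (λ x → ℤ.+ D ℤ.* x) (ℤ.pos-* c K)))))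
    cast-time : ℤ.+ (D * (t₁ + c * m)) ≡ ℤ.+ D ℤ.* (ℤ.+ t₁ ℤ.+ ℤ.+ c ℤ.* ℤ.+ m)
    cast-time = trans (ℤ.pos-* D (t₁ + c * m))
      (cong (λ x → ℤ.+ D ℤ.* x) (trans (ℤ.pos-+ t₁ (c * m)) (cong (λ x → ℤ.+ t₁ ℤ.+ x) (ℤ.pos-* c m))))
    regroup : ∀ A D c K Q t₁ m p →
      (A ℤ.+ D ℤ.* (c ℤ.* K)) ℤ.* Q ℤ.+ ℤ.- p ℤ.* (D ℤ.* (t₁ ℤ.+ c ℤ.* m)) ℤ.- (A ℤ.* Q ℤ.+ ℤ.- p ℤ.* (D ℤ.* t₁))
      ≡ c ℤ.* D ℤ.* (K ℤ.* Q ℤ.- p ℤ.* m)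
    regroup = ℤ-Solver.solve-∀

  numerator-grows : 1 ≤ ℤ.∣ drift ∣ → ∀ c → c * D ≤ ℤ.∣ numerator c ∣ + ℤ.∣ offset ∣
  numerator-grows 1≤∣drift∣ c = begin
    c * D                                ≡⟨ *-identityʳ (c * D) ⟨
    c * D * 1                            ≤⟨ *-monoʳ-≤ (c * D) 1≤∣drift∣ ⟩
    c * D * ℤ.∣ drift ∣                  ≡⟨ ℤ.abs-* (ℤ.+ (c * D)) drift ⟨
    ℤ.∣ ℤ.+ (c * D) ℤ.* drift ∣          ≡⟨ cong ℤ.∣_∣ (numerator-affine c) ⟨
    ℤ.∣ numerator c ℤ.- offset ∣         ≤⟨ ℤ.∣i-j∣≤∣i∣+∣j∣ (numerator c) offset ⟩
    ℤ.∣ numerator c ∣ + ℤ.∣ offset ∣     ∎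
    where open ≤-Reasoning

slope-of-progression : (f : ℕ → ℕ) (d′ : ℕ) (p : ℤ) (q′ t₀ m : ℕ) .{{_ : NonZero m}} (K : ℕ) →
                       (∀ c → f (suc t₀ + c * m) ≡ f (suc t₀) + suc d′ * (c * K)) →
                       AverageTendsTo d′ f (p ℚ./ suc q′) → ℤ.+ (K * suc q′) ≡ p ℤ.* ℤ.+ m
-- For ε = 1/(2mQ+1) the numerator at t₁ + c m is eventually below about c D / 2,
-- whereas a nonzero drift makes it at least c D minus a constant.
slope-of-progression f d′ p q′ t₀ m K progression tends =
  ℤ.i-j≡0⇒i≡j _ _ (ℤ.∣i∣≡0⇒i≡0 (n<1⇒n≡0 (≰⇒> λ 1≤∣drift∣ →
    progression-outgrows c D m Q ℤ.∣ numerator c ∣ ℤ.∣ offset ∣ t₁ (numerator-grows 1≤∣drift∣ c) small (m≤m+n _ K₀))))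
  where
  open ArithmeticProgression f d′ p q′ t₀ m K progression
  e = 2 * m * Q
  ε>0 : ℚ.0ℚᵘ ℚ.< mkℚᵘ (ℤ.+ 1) e
  ε>0 = ℚ.*<* (ℤ.+<+ z<s)
  K₀ = proj₁ (tends _ ε>0)
  c = D * t₁ * Q + ℤ.∣ offset ∣ * suc e + K₀
  small : ℤ.∣ numerator c ∣ * suc e < D * (t₁ + c * m) * Q
  small = distance<⇒numerator< (ℤ.+ f (t₁ + c * m)) p _ q′ e
            (proj₂ (tends _ ε>0) (t₀ + c * m) (≤-trans (m≤n+m K₀ _) (≤-trans (m≤m*n c m) (m≤n+m (c * m) t₀))))

rate-of-multiple : ∀ k P q j {m} → k * suc q ≡ P * m → m ≡ suc j * suc q → k ≡ suc j * P
rate-of-multiple k P q j {m} k[1+q]≡Pm m≡[1+j][1+q] = *-cancelʳ-≡ k (suc j * P) (suc q) (begin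
  k * suc q              ≡⟨ k[1+q]≡Pm ⟩
  P * m                  ≡⟨ cong (P *_) m≡[1+j][1+q] ⟩
  P * (suc j * suc q)    ≡⟨ *-assoc P (suc j) (suc q) ⟨
  P * suc j * suc q      ≡⟨ cong (_* suc q) (*-comm P (suc j)) ⟩
  suc j * P * suc q      ∎)
  where open ≡-Reasoning

module ChipFiring (n : ℕ) (σ : Config (suc n)) where

  N : ℕ
  N = suc n

  vertices : List (Fin N)
  vertices = allFin N

  config : ℕ → Config N
  config t = iterU t σ

  fired : ℕ → Fin N → ℕ
  fired t v = fires N (config t v)

  firings : ℕ → Fin N → ℕ
  firings zero    v = 0
  firings (suc t) v = firings t v + fired t v

  step-balance : ∀ t v → config (suc t) v + N * fired t v ≡ config t v + r (config t)
  step-balance t v with N ≤ᵇ config t v in N≤ᵇσₜv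
  ... | true  = begin
    config t v ∸ N + R + N * 1 ≡⟨ cong (config t v ∸ N + R +_) (*-identityʳ N) ⟩
    config t v ∸ N + R + N     ≡⟨ xy∙z≈xz∙y (config t v ∸ N) R N ⟩
    config t v ∸ N + N + R     ≡⟨ cong (_+ R) (m∸n+n≡m (≤ᵇ⇒≤ N (config t v) (subst T (sym N≤ᵇσₜv) _))) ⟩
    config t v + R             ∎
    where open ≡-Reasoning
          R = r (config t)
  ... | false = trans (cong (config t v + r (config t) +_) (*-zeroʳ N)) (+-identityʳ _)

  config+firings : ∀ t v → config t v + N * firings t v ≡ σ v + α σ t
  config+firings zero    v = cong (σ v +_) (*-zeroʳ N)
  config+firings (suc t) v = begin
    config (suc t) v + N * (firings t v + fired t v)       ≡⟨ cong (config (suc t) v +_) (*-distribˡ-+ N (firings t v) (fired t v)) ⟩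
    config (suc t) v + (N * firings t v + N * fired t v)   ≡⟨ x∙yz≈xz∙y (config (suc t) v) _ _ ⟩
    config (suc t) v + N * fired t v + N * firings t v     ≡⟨ cong (_+ N * firings t v) (step-balance t v) ⟩
    config t v + r (config t) + N * firings t v            ≡⟨ xy∙z≈xz∙y (config t v) _ _ ⟩
    config t v + N * firings t v + r (config t)            ≡⟨ cong (_+ r (config t)) (config+firings t v) ⟩
    σ v + α σ t + r (config t)                             ≡⟨ +-assoc (σ v) _ _ ⟩
    σ v + α σ (suc t)                                      ∎
    where open ≡-Reasoning

  config+firings+ : ∀ t v a → config t v + N * (firings t v + a) ≡ σ v + (α σ t + N * a)
  config+firings+ t v a = begin
    config t v + N * (firings t v + a)       ≡⟨ cong (config t v +_) (*-distribˡ-+ N _ a) ⟩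
    config t v + (N * firings t v + N * a)   ≡⟨ sym (+-assoc (config t v) _ _) ⟩
    config t v + N * firings t v + N * a     ≡⟨ cong (_+ N * a) (config+firings t v) ⟩
    σ v + α σ t + N * a                      ≡⟨ +-assoc (σ v) _ _ ⟩
    σ v + (α σ t + N * a)                    ∎
    where open ≡-Reasoning

  ∑firings≡α : ∀ t → ∑ vertices (firings t) ≡ α σ t
  ∑firings≡α zero    = trans (∑-allFin-const N 0) (*-zeroʳ N)
  ∑firings≡α (suc t) =
    trans (∑-distrib-+ vertices (firings t) (fired t)) (cong₂ _+_ (∑firings≡α t) (sym (r≡∑fires (config t))))

  ∑firings+ : ∀ t a → ∑ vertices (λ v → firings t v + a) ≡ α σ t + N * a
  ∑firings+ t a = trans (∑-distrib-+ vertices (firings t) (λ _ → a)) (cong₂ _+_ (∑firings≡α t) (∑-allFin-const N a))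

  ∑config≡∑σ : ∀ t → ∑ vertices (config t) ≡ ∑ vertices σ
  ∑config≡∑σ t = +-cancelʳ-≡ (N * α σ t) _ _ (begin
    ∑ vertices (config t) + N * α σ t                       ≡⟨ cong (λ a → ∑ vertices (config t) + N * a) (∑firings≡α t) ⟨
    ∑ vertices (config t) + N * ∑ vertices (firings t)      ≡⟨ cong (∑ vertices (config t) +_) (∑-*ˡ vertices N (firings t)) ⟨
    ∑ vertices (config t) + ∑ vertices (λ v → N * firings t v) ≡⟨ ∑-distrib-+ vertices (config t) _ ⟨
    ∑ vertices (λ v → config t v + N * firings t v)         ≡⟨ ∑-cong vertices (config+firings t) ⟩
    ∑ vertices (λ v → σ v + α σ t)                          ≡⟨ ∑-distrib-+ vertices σ _ ⟩
    ∑ vertices σ + ∑ vertices (λ _ → α σ t)                 ≡⟨ cong (∑ vertices σ +_) (∑-allFin-const N (α σ t)) ⟩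
    ∑ vertices σ + N * α σ t                                ∎)
    where open ≡-Reasoning

  config≤∑σ : ∀ t v → config t v ≤ ∑ vertices σ
  config≤∑σ t v = subst (config t v ≤_) (∑config≡∑σ t) (∈⇒≤∑ vertices (config t) (∈-allFin v))

  repeat⇒period : ∀ {i j} → i < j → (∀ v → config i v ≡ config j v) → IsEventualPeriodOf σ (j ∸ i)
  repeat⇒period {i} {j} i<j σᵢ≗σⱼ = i , ∀≥-from-offsets _ periodic
    where
    periodic : ∀ d v → config (d + i + (j ∸ i)) v ≡ config (d + i) v
    periodic d v = begin
      config (d + i + (j ∸ i)) v ≡⟨ cong (λ s → config s v) (trans (+-assoc d i _) (cong (d +_) (m+[n∸m]≡n (<⇒≤ i<j)))) ⟩
      config (d + j) v           ≡⟨ cong (λ τ → τ v) (iterU-+ d j σ) ⟩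
      iterU d (config j) v       ≡⟨ iterU-cong σᵢ≗σⱼ d v ⟨
      iterU d (config i) v       ≡⟨ cong (λ τ → τ v) (iterU-+ d i σ) ⟨
      config (d + i) v           ∎
      where open ≡-Reasoning

  eventually-periodic : ∃ λ m → 1 ≤ m × IsEventualPeriodOf σ m
  eventually-periodic =
    let i , j , i<j , σᵢ≗σⱼ = bounded-sequence-repeats (∑ vertices σ) config config≤∑σ
    in  j ∸ i , m<n⇒0<n∸m i<j , repeat⇒period i<j σᵢ≗σⱼ

  -- At a tie, config+firings+ makes the two piles compare as the right-hand sides of the hypothesis do.
  fired-mono-at-tie : ∀ {x y u v a b} → σ u + (α σ x + N * a) ≤ σ v + (α σ y + N * b) →
                      firings x u + a ≡ firings y v + b → fired x u ≤ fired y v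
  fired-mono-at-tie {x} {y} {u} {v} {a} {b} le tie =
    fires-mono N (+-cancelʳ-≤ (N * (firings y v + b)) (config x u) (config y v) (begin
      config x u + N * (firings y v + b) ≡⟨ cong (λ f → config x u + N * f) tie ⟨
      config x u + N * (firings x u + a) ≡⟨ config+firings+ x u a ⟩
      σ u + (α σ x + N * a)              ≤⟨ le ⟩
      σ v + (α σ y + N * b)              ≡⟨ config+firings+ y v b ⟨
      config y v + N * (firings y v + b) ∎))
    where open ≤-Reasoning

  firings-step : ∀ {x y u v a b} → σ u + (α σ x + N * a) ≤ σ v + (α σ y + N * b) →
                 firings x u + a ≤ firings y v + b → firings (suc x) u + a ≤ firings (suc y) v + b
  firings-step {x} {y} {u} {v} {a} {b} le h =
    subst₂ _≤_ (xy∙z≈xz∙y (firings x u) a (fired x u)) (xy∙z≈xz∙y (firings y v) b (fired y v))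
      (+-mono-≤-unless-tie h (fired-mono-at-tie {x} {y} {u} {v} {a} {b} le) (fires≤1 N (config x u)))

  shift-comparison : ∀ {x y a b} → (∀ u → firings x u + a ≤ firings y u + b) →
                     ∀ d u → firings (d + x) u + a ≤ firings (d + y) u + b
  shift-comparison         h zero    u = h u
  shift-comparison {x} {y} {a} {b} h (suc d) u =
    firings-step {d + x} {d + y} {u} {u} {a} {b}
      (+-monoʳ-≤ (σ u) (subst₂ _≤_ (∑firings+ (d + x) a) (∑firings+ (d + y) b) (∑-mono-≤ vertices IH)))
      (IH u)
    where IH = shift-comparison {x} {y} {a} {b} h d

  vertex-comparison : ∀ {u v a b} → σ u + N * a ≤ σ v + N * b →
                      ∀ {t} → firings t u + a ≤ firings t v + b →
                      ∀ d → firings (d + t) u + a ≤ firings (d + t) v + b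
  vertex-comparison                   le h zero    = h
  vertex-comparison {u} {v} {a} {b} le {t} h (suc d) =
    firings-step {d + t} {d + t} {u} {v} {a} {b}
      (subst₂ _≤_ (x∙yz≈y∙xz (α σ (d + t)) (σ u) (N * a)) (x∙yz≈y∙xz (α σ (d + t)) (σ v) (N * b))
                  (+-monoʳ-≤ (α σ (d + t)) le))
      (vertex-comparison le {t} h d)

  firings-mono-+ : ∀ d t v → firings t v ≤ firings (d + t) v
  firings-mono-+ zero    t v = ≤-refl
  firings-mono-+ (suc d) t v = ≤-trans (firings-mono-+ d t v) (m≤m+n _ (fired (d + t) v))

  module Periodic (m : ℕ) {{_ : NonZero m}} (T : ℕ)
                  (periodic : ∀ t → T ≤ t → ∀ v → config (t + m) v ≡ config t v) where

    increment : Fin N → ℕ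
    increment v = firings (T + m) v ∸ firings T v

    firings-over-period : ∀ t → T ≤ t → ∀ v → firings (t + m) v ≡ firings t v + increment v
    firings-over-period = ∀≥-from-offsets _ from-T
      where
      from-T : ∀ d v → firings (d + T + m) v ≡ firings (d + T) v + increment v
      from-T zero    v = sym (m+[n∸m]≡n (subst (λ s → firings T v ≤ firings s v) (+-comm m T) (firings-mono-+ m T v)))
      from-T (suc d) v = begin
        firings (d + T + m) v + fired (d + T + m) v          ≡⟨ cong₂ _+_ (from-T d v) (cong (fires N) (periodic (d + T) (m≤n+m T d) v)) ⟩
        firings (d + T) v + increment v + fired (d + T) v    ≡⟨ xy∙z≈xz∙y (firings (d + T) v) _ _ ⟩
        firings (suc d + T) v + increment v                  ∎
        where open ≡-Reasoning

    α-over-period : ∀ v → α σ (T + m) ≡ α σ T + N * increment v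
    α-over-period v = +-cancelˡ-≡ (σ v) _ _ (begin
      σ v + α σ (T + m)                          ≡⟨ config+firings (T + m) v ⟨
      config (T + m) v + N * firings (T + m) v   ≡⟨ cong₂ (λ c f → c + N * f) (periodic T ≤-refl v) (firings-over-period T ≤-refl v) ⟩
      config T v + N * (firings T v + increment v) ≡⟨ config+firings+ T v (increment v) ⟩
      σ v + (α σ T + N * increment v)            ∎)
      where open ≡-Reasoning

    firingsPerPeriod : ℕ
    firingsPerPeriod = increment Fin.zero

    increment-uniform : ∀ v → increment v ≡ firingsPerPeriod
    increment-uniform v =
      *-cancelˡ-≡ _ _ N (+-cancelˡ-≡ (α σ T) _ _ (trans (sym (α-over-period v)) (α-over-period Fin.zero)))

    firings-after-periods : ∀ c t → T ≤ t → ∀ v → firings (t + c * m) v ≡ firings t v + c * firingsPerPeriod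
    firings-after-periods zero    t T≤t v = trans (cong (λ s → firings s v) (+-identityʳ t)) (sym (+-identityʳ _))
    firings-after-periods (suc c) t T≤t v = begin
      firings (t + (m + c * m)) v                            ≡⟨ cong (λ s → firings s v) (x∙yz≈xz∙y t m (c * m)) ⟩
      firings (t + c * m + m) v                              ≡⟨ firings-over-period (t + c * m) (≤-trans T≤t (m≤m+n t _)) v ⟩
      firings (t + c * m) v + increment v                    ≡⟨ cong₂ _+_ (firings-after-periods c t T≤t v) (increment-uniform v) ⟩
      firings t v + c * firingsPerPeriod + firingsPerPeriod  ≡⟨ xy∙z≈x∙zy (firings t v) _ _ ⟩
      firings t v + suc c * firingsPerPeriod                 ∎
      where open ≡-Reasoning

    α-after-periods : ∀ c t → T ≤ t → α σ (t + c * m) ≡ α σ t + N * (c * firingsPerPeriod)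
    α-after-periods c t T≤t = begin
      α σ (t + c * m)                                       ≡⟨ ∑firings≡α (t + c * m) ⟨
      ∑ vertices (firings (t + c * m))                      ≡⟨ ∑-cong vertices (firings-after-periods c t T≤t) ⟩
      ∑ vertices (λ v → firings t v + c * firingsPerPeriod) ≡⟨ ∑firings+ t (c * firingsPerPeriod) ⟩
      α σ t + N * (c * firingsPerPeriod)                    ∎
      where open ≡-Reasoning

    window-balance : ∀ t → T ≤ t → ∀ d u v → firings (d + t) u + firings t v ≤ firings (d + t) v + suc (firings t u)
    window-balance t T≤t d u v with σ u + N * firings t v ≤? σ v + N * suc (firings t u)
    ... | yes u-behind = vertex-comparison u-behind {t} now d
      where
      now : firings t u + firings t v ≤ firings t v + suc (firings t u)
      now = ≤-trans (≤-reflexive (+-comm (firings t u) (firings t v))) (+-monoʳ-≤ (firings t v) (n≤1+n (firings t u)))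
    ... | no u-ahead with firings (d + t) u + firings t v ≤? firings (d + t) v + suc (firings t u)
    ...   | yes balanced  = balanced
    -- u stays ahead by two forever, yet after d periods both vertices have gained exactly d k firings.
    ...   | no unbalanced = ⊥-elim (<-irrefl (xy∙z≈zy∙x (firings t v) _ (firings t u)) (begin-strict
      firings t v + d * firingsPerPeriod + firings t u            <⟨ ≤-reflexive (sym (+-suc _ _)) ⟩
      firings t v + d * firingsPerPeriod + suc (firings t u)      ≡⟨ cong (_+ suc (firings t u)) (firings-after-periods d t T≤t v) ⟨
      firings (t + d * m) v + suc (firings t u)                   ≡⟨ cong (λ s → firings s v + suc (firings t u)) lands ⟨
      firings (e + (d + t)) v + suc (firings t u)                 ≤⟨ persists ⟩
      firings (e + (d + t)) u + firings t v                       ≡⟨ cong (λ s → firings s u + firings t v) lands ⟩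
      firings (t + d * m) u + firings t v                         ≡⟨ cong (_+ firings t v) (firings-after-periods d t T≤t u) ⟩
      firings t u + d * firingsPerPeriod + firings t v            ∎))
      where
      open ≤-Reasoning
      e = d * m ∸ d
      lands : e + (d + t) ≡ t + d * m
      lands = trans (sym (+-assoc e d t)) (trans (cong (_+ t) (m∸n+n≡m (m≤m*n d m))) (+-comm (d * m) t))
      persists : firings (e + (d + t)) v + suc (firings t u) ≤ firings (e + (d + t)) u + firings t v
      persists = vertex-comparison (<⇒≤ (≰⇒> u-ahead)) {d + t} (<⇒≤ (≰⇒> unbalanced)) e

    dichotomy : ∀ t → T ≤ t → ∀ d P → (∀ u → firings t u + P ≤ firings (d + t) u) ⊎ (∀ u → firings (d + t) u ≤ firings t u + P)
    dichotomy t T≤t d P with all? (λ u → firings t u + P ≤? firings (d + t) u)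
    ... | yes grows = inj₁ grows
    ... | no ¬grows =
      let u₀ , lags = ¬∀⟶∃¬ N _ (λ u → firings t u + P ≤? firings (d + t) u) ¬grows
      in  inj₂ λ v → +-cancelʳ-≤ (firings t u₀) _ _ (begin
            firings (d + t) v + firings t u₀        ≤⟨ window-balance t T≤t d v u₀ ⟩
            firings (d + t) u₀ + suc (firings t v)  ≡⟨ +-suc _ _ ⟩
            suc (firings (d + t) u₀ + firings t v)  ≤⟨ +-monoˡ-≤ (firings t v) (≰⇒> lags) ⟩
            firings t u₀ + P + firings t v          ≡⟨ xy∙z≈zy∙x (firings t u₀) P (firings t v) ⟩
            firings t v + P + firings t u₀          ∎)
      where open ≤-Reasoning

    module _ {Q j P : ℕ} (m≡[1+j]Q : m ≡ suc j * Q) (k≡[1+j]P : firingsPerPeriod ≡ suc j * P) where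

      firings-over-subperiod : ∀ t → T ≤ t → ∀ u → firings (Q + t) u ≡ firings t u + P
      firings-over-subperiod t T≤t u =
        trans (cong (λ s → firings (s + t) u) (sym (+-identityʳ Q))) (forced (dichotomy t T≤t Q P))
        where
        open ≡-Reasoning
        sample : ℕ → ℕ
        sample i = firings (i * Q + t) u
        next : ∀ i → firings (i * Q + (Q + t)) u + 0 ≡ sample (suc i)
        next i = trans (+-identityʳ _) (cong (λ s → firings s u) (trans (x∙yz≈y∙xz (i * Q) Q t) (sym (+-assoc Q (i * Q) t))))
        endpoint : sample (suc j) ≡ sample 0 + suc j * P
        endpoint = begin
          firings (suc j * Q + t) u  ≡⟨ cong (λ s → firings (s + t) u) m≡[1+j]Q ⟨
          firings (m + t) u          ≡⟨ cong (λ s → firings s u) (+-comm m t) ⟩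
          firings (t + m) u          ≡⟨ firings-over-period t T≤t u ⟩
          firings t u + increment u  ≡⟨ cong (firings t u +_) (trans (increment-uniform u) k≡[1+j]P) ⟩
          firings t u + suc j * P    ∎
        forced : (∀ u → firings t u + P ≤ firings (Q + t) u) ⊎ (∀ u → firings (Q + t) u ≤ firings t u + P) →
                 sample 1 ≡ sample 0 + P
        forced (inj₁ grows)   = forced-step-≥ sample P j endpoint λ i →
          subst (sample i + P ≤_) (next i)
            (shift-comparison {t} {Q + t} {P} {0} (λ u → subst (_ ≤_) (sym (+-identityʳ _)) (grows u)) (i * Q) u)
        forced (inj₂ shrinks) = forced-step-≤ sample P j endpoint λ i →
          subst (_≤ sample i + P) (next i)
            (shift-comparison {Q + t} {t} {0} {P} (λ u → subst (_≤ _) (sym (+-identityʳ _)) (shrinks u)) (i * Q) u)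

      subperiod : IsEventualPeriodOf σ Q
      subperiod = T , λ t T≤t v → +-cancelʳ-≡ (N * (firings t v + P)) _ _ (begin
        config (t + Q) v + N * (firings t v + P)      ≡⟨ cong (λ s → config s v + N * (firings t v + P)) (+-comm t Q) ⟩
        config (Q + t) v + N * (firings t v + P)      ≡⟨ cong (λ f → config (Q + t) v + N * f) (firings-over-subperiod t T≤t v) ⟨
        config (Q + t) v + N * firings (Q + t) v      ≡⟨ config+firings (Q + t) v ⟩
        σ v + α σ (Q + t)                             ≡⟨ cong (σ v +_) (α-over-subperiod t T≤t) ⟩
        σ v + (α σ t + N * P)                         ≡⟨ config+firings+ t v P ⟨
        config t v + N * (firings t v + P)            ∎)
        where
        open ≡-Reasoning
        α-over-subperiod : ∀ t → T ≤ t → α σ (Q + t) ≡ α σ t + N * P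
        α-over-subperiod t T≤t = trans (sym (∑firings≡α (Q + t))) (trans (∑-cong vertices (firings-over-subperiod t T≤t)) (∑firings+ t P))

    module _ (p : ℤ) (q : ℕ) (activity : HasActivity σ (p ℚ./ suc q)) where

      firingsPerPeriod-rate : firingsPerPeriod * suc q ≡ ℤ.∣ p ∣ * m
      firingsPerPeriod-rate = trans
        (cong ℤ.∣_∣ (slope-of-progression (α σ) n p q T m firingsPerPeriod (λ c → α-after-periods c (suc T) (n≤1+n T)) activity))
        (ℤ.abs-* p (ℤ.+ m))

      module _ (coprime : Coprime ℤ.∣ p ∣ (suc q)) where

        1+q∣period : suc q ∣ m
        1+q∣period = coprime-divisor (Coprime.sym coprime) (divides firingsPerPeriod (sym firingsPerPeriod-rate))

        1+q-period : IsEventualPeriodOf σ (suc q)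
        1+q-period = multiple⇒period 1+q∣period
          where
          multiple⇒period : suc q ∣ m → IsEventualPeriodOf σ (suc q)
          multiple⇒period (divides zero    m≡0)          = ⊥-elim (≢-nonZero⁻¹ m m≡0)
          multiple⇒period (divides (suc j) m≡[1+j][1+q]) =
            subperiod {suc q} {j} {ℤ.∣ p ∣} m≡[1+j][1+q] (rate-of-multiple firingsPerPeriod ℤ.∣ p ∣ q j firingsPerPeriod-rate m≡[1+j][1+q])

lemma4p7 : (n : ℕ) (σ : Config (suc n)) (p : ℤ) (q : ℕ) →
           Coprime ℤ.∣ p ∣ (suc q) →
           HasActivity σ (p ℚ./ suc q) →
           EventualPeriod σ (suc q)
lemma4p7 n σ p q coprime activity = (z<s , 1+q-period) , minimal
  where
  open ChipFiring n σ
  1+q-period : IsEventualPeriodOf σ (suc q)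
  1+q-period =
    let m₀ , 1≤m₀ , T₀ , periodic₀ = eventually-periodic
    in  Periodic.1+q-period m₀ {{>-nonZero 1≤m₀}} T₀ periodic₀ p q activity coprime
  minimal : ∀ m → 1 ≤ m → IsEventualPeriodOf σ m → suc q ≤ m
  minimal m 1≤m (T , periodic) =
    ∣⇒≤ {{>-nonZero 1≤m}} (Periodic.1+q∣period m {{>-nonZero 1≤m}} T periodic p q activity coprime)
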